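{- Let $H$ be a $2$-vertex-connected graph on $n$ vertices. Suppose there is a vertex $v\in V(H)$ such that $H_{\mathrm{asym}}:=H-v$ is rigid (its only automorphism is the identity) and the following condition $(*)$ holds: $(*)$ Let $v^1,\dots,v^k$ be the vertices of $H$ with $H-v^i\cong H-v\cong H_{\mathrm{asym}}$ for all $i\in[k]$. If $k\ge 2$, then every $w\in V(H)$ lies in the same automorphism orbit of $H_{\mathrm{asym}}$ regardless of which of the vertices $v^i\neq w$ has been removed. Equivalently: for every $w\in V(H)$ and all $i,j\in[k]$ with $v^i\neq w\neq v^j$, there is an isomorphism $H-v^i\to H-v^j$ mapping $w$ to $w$. Then $H$ is reconstructible from its $(n-1)$-graphlet degree distribution. That is, every graph $H'$ on $n$ vertices whose $(n-1)$-graphlet degree distribution equals that of $H$ (for suitable orderings of the vertex sets) is isomorphic to $H$.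
   Context: All graphs are finite, simple and undirected. Let $H$ be a graph on $n$ vertices. A graphlet is a pair $(G,r)$ where $G$ is a connected graph with at least one and fewer than $n$ vertices, and $r\in V(G)$ is its root. Two graphlets $(G,r)$ and $(G',r')$ are isomorphic if some isomorphism $G\to G'$ maps $r$ to $r'$. Graphlets are considered up to this isomorphism, in a fixed enumeration of the isomorphism classes. For $v\in V(H)$ and a graphlet $(G,r)$, the graphlet degree of $v$ is the number of vertex sets $S\subseteq V(H)$ with $v\in S$ such that some isomorphism from the induced subgraph $H[S]$ onto $G$ maps $v$ to $r$. The $m$-graphlet degree sequence ($m$-gds) of $v$ is the vector of graphlet degrees of $v$ over all graphlet classes with exactly $m$ vertices. The $(\le m)$-gds of $v$ is the same vector over all graphlet classes with at most $m$ vertices. The $m$-graphlet degree distribution ($m$-gdd), respectively the $(\le m)$-gdd, of $H$ is the matrix whose rows are the $m$-gds, respectively $(\le m)$-gds, of the vertices of $H$. Rows are indexed by an ordering of $V(H)$ and columns by graphlet classes. -}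

module Defs where

open import Data.Nat using (ℕ; suc; _≤_)
open import Data.Bool using (Bool; true; false)
open import Data.Fin using (Fin; punchIn; punchOut)
open import Data.Fin.Subset using (Subset)
import Data.Fin.Subset as Sub
open import Data.List using (List; length)
open import Data.List.Membership.Propositional using () renaming (_∈_ to _∈L_)
open import Data.List.Relation.Unary.Unique.Propositional using (Unique)
open import Data.Product using (Σ; ∃; _×_; _,_)
open import Function.Bundles using (_⤖_; _⇔_; Bijection)
open import Function.Definitions using (Injective)
open import Relation.Binary.PropositionalEquality using (_≡_; _≢_)

record Graph (n : ℕ) : Set where
  field
    adj   : Fin n → Fin n → Bool
    sym   : ∀ x y → adj x y ≡ adj y x
    irref : ∀ x → adj x x ≡ false
open Graph public

record Iso {n m : ℕ} (G : Graph n) (H : Graph m) : Set where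
  field
    bij  : Fin n ⤖ Fin m
    pres : ∀ x y → adj G x y ≡ adj H (Bijection.to bij x) (Bijection.to bij y)
open Iso public

isoMap : ∀ {n m} {G : Graph n} {H : Graph m} → Iso G H → Fin n → Fin m
isoMap f = Bijection.to (bij f)

-- Vertex deletion H - v (vertices of H - v are identified with Fin m via punchIn v).
_─_ : ∀ {m} → Graph (suc m) → Fin (suc m) → Graph m
adj   (H ─ v) x y = adj H (punchIn v x) (punchIn v y)
sym   (H ─ v) x y = sym H (punchIn v x) (punchIn v y)
irref (H ─ v) x   = irref H (punchIn v x)

data Reachable {n} (G : Graph n) : Fin n → Fin n → Set where
  here : ∀ {x} → Reachable G x x
  step : ∀ {x y z} → adj G x y ≡ true → Reachable G y z → Reachable G x z

Connected : ∀ {n} → Graph n → Set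
Connected G = ∀ x y → Reachable G x y

TwoConnected : ∀ {m} → Graph (suc m) → Set
TwoConnected {m} H = (3 ≤ suc m) × Connected H × (∀ x → Connected (H ─ x))

Rigid : ∀ {n} → Graph n → Set
Rigid G = (f : Iso G G) → ∀ x → isoMap f x ≡ x

-- Condition (*), in its "equivalently" form: for all w and all vertices a, b
-- with H - a ≅ H - v and H - b ≅ H - v, a ≠ w ≠ b, there is an isomorphism
-- H - a → H - b mapping w to w.
StarCondition : ∀ {m} → Graph (suc m) → Fin (suc m) → Set
StarCondition H v =
  ∀ (w a b : Fin _) → Iso (H ─ a) (H ─ v) → Iso (H ─ b) (H ─ v) →
  (a≢w : a ≢ w) (b≢w : b ≢ w) →
  Σ (Iso (H ─ a) (H ─ b)) λ f → isoMap f (punchOut a≢w) ≡ punchOut b≢w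

CountIs : ∀ {n} → (Subset n → Set) → ℕ → Set
CountIs {n} P k =
  Σ (List (Subset n)) λ L → Unique L × length L ≡ k × (∀ S → P S ⇔ (S ∈L L))

-- There is an isomorphism from the induced subgraph H[S] onto G mapping v to r.
-- Written out via its inverse: an injective map g : V(G) → V(H) with image
-- exactly S, preserving (non-)adjacency, with g r = v.
InducedIsoRooted : ∀ {n m} → Graph n → Subset n → Fin n → Graph m → Fin m → Set
InducedIsoRooted {n} {m} H S v G r =
  v Sub.∈ S ×
  Σ (Fin m → Fin n) λ g →
    Injective _≡_ _≡_ g ×
    (∀ y → y Sub.∈ S ⇔ ∃ λ a → g a ≡ y) ×
    (∀ a b → adj G a b ≡ adj H (g a) (g b)) ×
    g r ≡ v

GraphletDegreeIs : ∀ {n m} → Graph n → Fin n → Graph m → Fin m → ℕ → Set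
GraphletDegreeIs H v G r k = CountIs (λ S → InducedIsoRooted H S v G r) k

SameGDD : ∀ {m} → Graph (suc m) → Graph (suc m) → Set
SameGDD {m} H H' =
  Σ (Fin (suc m) ⤖ Fin (suc m)) λ σ →
    ∀ x (G : Graph m) → Connected G → (r : Fin m) → (k : ℕ) →
      GraphletDegreeIs H x G r k ⇔ GraphletDegreeIs H' (Bijection.to σ x) G r k

-- An (n−1)-vertex graphlet at x is a card H − u (u ≠ x) with x marked, so a bijection σ
-- preserving (n−1)-graphlet degrees transfers such rooted cards between H and H'.
-- By rigidity and (*), all isomorphisms H − a ≅ H − v agree on the vertices they share. Hence every
-- isomorphism H' − u' ≅ H − v sends σ x to x, at most one such u' differs from σ v, and so
-- H' − σ v ≅ H − v: σ preserves adjacency away from v. For the pair x, v, counting neighbours of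
-- x in H and of σ x in H' through the card deleting v and through any other card shows that a
-- mismatch makes x adjacent to all other vertices. Then σ x is adjacent in H' to all but σ v,
-- which forces σ v to be isolated in H', whereas the connected card H − x gives v a neighbour.

module Submission where

open import Defs hiding (sym)
import Algebra.Properties.CommutativeMonoid.Sum as Sum
open import Data.Bool using (Bool; true; false)
import Data.Bool.Properties as Bool
open import Data.List using ([])
open import Data.List.Relation.Unary.Unique.Propositional using ([])
open import Data.Fin using (Fin; zero; suc; punchIn; punchOut; opposite)
open import Data.Fin.Properties
  using (_≟_; any?; all?; injective⇒≤; punchIn-injective; punchInᵢ≢i; punchOut-injective;
         punchOut-cong; punchIn-punchOut; punchOut-punchIn; opposite-involutive)
open import Data.Fin.Subset using (∁; ⁅_⁆)
import Data.Fin.Subset as Sub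
open import Data.Fin.Subset.Properties using (x∉p⇒x∈∁p; x∈∁p⇒x∉p; x∈⁅y⁆⇒x≡y; x∈⁅x⁆)
open import Data.Nat as ℕ using (ℕ; suc; _+_)
import Data.Nat.Properties as ℕ
open import Data.Product using (Σ; ∃; _,_; proj₁; proj₂; curry)
open import Function using (_∘_)
open import Function.Bundles using (_⤖_; Bijection; Equivalence; mk⤖; mk⇔)
open import Function.Consequences.Propositional using (strictlySurjective⇒surjective)
import Function.Construct.Composition as Compose
import Function.Construct.Identity as Identity
import Function.Construct.Symmetry as Symmetry
open import Function.Definitions using (Injective; StrictlySurjective)
open import Function.Properties.Bijection using (⤖⇒↔)
open import Relation.Binary.PropositionalEquality
  using (_≡_; _≢_; refl; sym; trans; cong; cong₂; subst; module ≡-Reasoning)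
open import Relation.Nullary using (¬_; ¬?; contradiction; yes; no)
open import Relation.Nullary.Decidable using (decidable-stable)
open import Algebra.Properties.CommutativeSemigroup ℕ.+-commutativeSemigroup
  using (xy∙z≈xz∙y; xy∙z≈x∙zy; x∙yz≈yx∙z)
open Sum ℕ.+-0-commutativeMonoid using (sum; sum-cong-≗; sum-remove; sum-permute)

private variable
  k n : ℕ

∃-notInImage : k ℕ.< n → (f : Fin k → Fin n) → ∃ λ y → ∀ a → f a ≢ y
∃-notInImage k<n f =
  decidable-stable (any? λ y → all? λ a → ¬? (f a ≟ y)) λ allHit →
    let hit : ∀ y → ∃ λ a → f a ≡ y
        hit y = decidable-stable (any? λ a → f a ≟ y) λ missed → allHit (y , λ a → missed ∘ (a ,_))
    in ℕ.<⇒≱ k<n (injective⇒≤ {f = proj₁ ∘ hit} λ {y} {y′} eq →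
         trans (sym (proj₂ (hit y))) (trans (cong f eq) (proj₂ (hit y′))))

injective⇒surjective : {f : Fin n → Fin n} → Injective _≡_ _≡_ f → StrictlySurjective _≡_ f
injective⇒surjective {suc n} {f} f-inj y =
  decidable-stable (any? λ a → f a ≟ y) λ missed →
    let y≢f : ∀ a → y ≢ f a
        y≢f a = missed ∘ (a ,_) ∘ sym
    in ℕ.1+n≰n (injective⇒≤ {f = λ a → punchOut (y≢f a)}
                 λ {a} {b} → f-inj ∘ punchOut-injective (y≢f a) (y≢f b))

punchIn≡⇒≡punchOut : ∀ {i j : Fin (suc n)} {y} (i≢j : i ≢ j) → punchIn i y ≡ j → y ≡ punchOut i≢j
punchIn≡⇒≡punchOut {i = i} _ eq = trans (sym (punchOut-punchIn i)) (punchOut-cong i eq)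

module _ {n₁ n₂} {G : Graph n₁} {K : Graph n₂} (f : Iso G K) where

  isoMap-injective : Injective _≡_ _≡_ (isoMap f)
  isoMap-injective = Bijection.injective (bij f)

  isoMap⁻¹ : Fin n₂ → Fin n₁
  isoMap⁻¹ = Bijection.to⁻ (bij f)

  isoMap∘isoMap⁻¹ : ∀ y → isoMap f (isoMap⁻¹ y) ≡ y
  isoMap∘isoMap⁻¹ y = proj₂ (Bijection.surjective (bij f) y) refl

  isoMap⁻¹∘isoMap : ∀ x → isoMap⁻¹ (isoMap f x) ≡ x
  isoMap⁻¹∘isoMap x = isoMap-injective (isoMap∘isoMap⁻¹ (isoMap f x))

  adj-isoMap⁻¹ : ∀ x y → adj K x y ≡ adj G (isoMap⁻¹ x) (isoMap⁻¹ y)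
  adj-isoMap⁻¹ x y = begin
    adj K x y                                             ≡⟨ cong₂ (adj K) (isoMap∘isoMap⁻¹ x) (isoMap∘isoMap⁻¹ y) ⟨
    adj K (isoMap f (isoMap⁻¹ x)) (isoMap f (isoMap⁻¹ y)) ≡⟨ pres f _ _ ⟨
    adj G (isoMap⁻¹ x) (isoMap⁻¹ y)                       ∎
    where open ≡-Reasoning

Iso-refl : {G : Graph n} → Iso G G
Iso-refl = record { bij = Identity.⤖-id _ ; pres = λ _ _ → refl }

Iso-sym : ∀ {n₁ n₂} {G : Graph n₁} {K : Graph n₂} → Iso G K → Iso K G
Iso-sym f = record { bij = Symmetry.bijection-≡ (bij f) ; pres = adj-isoMap⁻¹ f }

Iso-trans : ∀ {n₁ n₂ n₃} {G : Graph n₁} {K : Graph n₂} {L : Graph n₃} →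
            Iso G K → Iso K L → Iso G L
Iso-trans f g = record
  { bij  = bij g Compose.⤖-∘ bij f
  ; pres = λ x y → trans (pres f x y) (pres g _ _)
  }

endoIso : {G K : Graph n} (f : Fin n → Fin n) → Injective _≡_ _≡_ f →
          (∀ x y → adj G x y ≡ adj K (f x) (f y)) → Iso G K
endoIso f f-inj f-pres = record
  { bij  = mk⤖ (f-inj , strictlySurjective⇒surjective (injective⇒surjective f-inj))
  ; pres = f-pres
  }

¬rigid-2 : (G : Graph 2) → ¬ Rigid G
¬rigid-2 G rigid = contradiction (rigid (endoIso opposite opposite-injective opposite-pres) zero) λ ()
  where
  opposite-injective : Injective _≡_ _≡_ opposite
  opposite-injective {a} {b} eq =
    trans (sym (opposite-involutive a)) (trans (cong opposite eq) (opposite-involutive b))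
  opposite-pres : ∀ a b → adj G a b ≡ adj G (opposite a) (opposite b)
  opposite-pres zero       zero       = trans (irref G zero) (sym (irref G (suc zero)))
  opposite-pres zero       (suc zero) = Graph.sym G zero (suc zero)
  opposite-pres (suc zero) zero       = Graph.sym G (suc zero) zero
  opposite-pres (suc zero) (suc zero) = trans (irref G (suc zero)) (sym (irref G zero))

module _ {n} {G : Graph n} where

  Reachable-trans : ∀ {x y z} → Reachable G x y → Reachable G y z → Reachable G x z
  Reachable-trans here         q = q
  Reachable-trans (step x~y p) q = step x~y (Reachable-trans p q)

  Reachable-sym : ∀ {x y} → Reachable G x y → Reachable G y x
  Reachable-sym here                       = here
  Reachable-sym (step {x} {y} x~y p) =
    Reachable-trans (Reachable-sym p) (step (trans (Graph.sym G y x) x~y) here)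

  Reachable⇒neighbour : ∀ {x y} → Reachable G x y → x ≢ y → ∃ λ z → adj G x z ≡ true
  Reachable⇒neighbour here                 x≢x = contradiction refl x≢x
  Reachable⇒neighbour (step {y = z} x~z _) _   = z , x~z

hub⇒connected : (G : Graph n) {h e w : Fin n} → (∀ y → y ≢ h → y ≢ e → adj G h y ≡ true) →
                adj G e w ≡ true → w ≢ h → Connected G
hub⇒connected G {h} {e} {w} hub e~w w≢h a b = Reachable-trans (toHub a) (Reachable-sym (toHub b))
  where
  w≢e : w ≢ e
  w≢e refl = contradiction (trans (sym (irref G w)) e~w) λ ()
  y~h : ∀ y → y ≢ h → y ≢ e → adj G y h ≡ true
  y~h y y≢h y≢e = trans (Graph.sym G y h) (hub y y≢h y≢e)
  toHub : ∀ y → Reachable G y h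
  toHub y with y ≟ h | y ≟ e
  ... | yes refl | _        = here
  ... | no _     | yes refl = step e~w (step (y~h w w≢h w≢e) here)
  ... | no y≢h   | no y≢e   = step (y~h y y≢h y≢e) here

hub─-connected : (K : Graph (suc n)) {h e w u : Fin (suc n)} →
                 (∀ y → y ≢ h → y ≢ e → adj K h y ≡ true) → adj K h e ≡ false → adj K e w ≡ true →
                 (u≢h : u ≢ h) (u≢e : u ≢ e) (u≢w : u ≢ w) → Connected (K ─ u)
hub─-connected K {h} {e} {w} {u} hub h≁e e~w u≢h u≢e u≢w = hub⇒connected (K ─ u) {w = punchOut u≢w}
  (λ y y≢h° y≢e° → trans (cong (λ z → adj K z (punchIn u y)) (punchIn-punchOut u≢h))
                         (hub _ (y≢h° ∘ punchIn≡⇒≡punchOut u≢h) (y≢e° ∘ punchIn≡⇒≡punchOut u≢e)))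
  (trans (cong₂ (adj K) (punchIn-punchOut u≢e) (punchIn-punchOut u≢w)) e~w)
  λ w°≡h° → contradiction
    (trans (sym h≁e) (trans (Graph.sym K h e)
           (trans (cong (adj K e) (sym (punchOut-injective u≢w u≢h w°≡h°))) e~w))) λ ()

bit : Bool → ℕ
bit false = 0
bit true  = 1

degree : Graph n → Fin n → ℕ
degree G x = sum λ y → bit (adj G x y)

degree-iso : ∀ {G K : Graph n} (f : Iso G K) x → degree G x ≡ degree K (isoMap f x)
degree-iso {G = G} {K} f x = begin
  sum (λ y → bit (adj G x y))                       ≡⟨ sum-cong-≗ (cong bit ∘ pres f x) ⟩
  sum (λ y → bit (adj K (isoMap f x) (isoMap f y))) ≡⟨ sum-permute _ (⤖⇒↔ (bij f)) ⟨
  degree K (isoMap f x)                             ∎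
  where open ≡-Reasoning

degree-─ : ∀ (G : Graph (suc n)) {u x} (u≢x : u ≢ x) →
           degree G x ≡ bit (adj G x u) + degree (G ─ u) (punchOut u≢x)
degree-─ G {u} {x} u≢x = begin
  degree G x                                                ≡⟨ sum-remove {i = u} (λ y → bit (adj G x y)) ⟩
  bit (adj G x u) + sum (λ y → bit (adj G x (punchIn u y))) ≡⟨ cong (bit (adj G x u) +_) (sum-cong-≗ x°-neighbours) ⟨
  bit (adj G x u) + degree (G ─ u) (punchOut u≢x)           ∎
  where
  open ≡-Reasoning
  x°-neighbours : ∀ y → bit (adj (G ─ u) (punchOut u≢x) y) ≡ bit (adj G x (punchIn u y))
  x°-neighbours y = cong (λ z → bit (adj G z (punchIn u y))) (punchIn-punchOut u≢x)

+-balance : ∀ a b c d {k r} → a + k ≡ b + r → c + k ≡ d + r → a + d ≡ c + b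
+-balance a b c d {k} {r} a+k≡b+r c+k≡d+r = ℕ.+-cancelʳ-≡ k _ _ (begin
  a + d + k     ≡⟨ xy∙z≈xz∙y a d k ⟩
  a + k + d     ≡⟨ cong (_+ d) a+k≡b+r ⟩
  b + r + d     ≡⟨ xy∙z≈x∙zy b r d ⟩
  b + (d + r)   ≡⟨ cong (b +_) c+k≡d+r ⟨
  b + (c + k)   ≡⟨ x∙yz≈yx∙z b c k ⟩
  c + b + k     ∎)
  where open ≡-Reasoning

bit-balance : ∀ {a b c d} → bit a + bit b ≡ bit c + bit d → a ≢ c → d ≡ a
bit-balance {false} {_}     {false} {_}     _  a≢c = contradiction refl a≢c
bit-balance {true}  {_}     {true}  {_}     _  a≢c = contradiction refl a≢c
bit-balance {false} {_}     {true}  {false} _  _   = refl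
bit-balance {false} {false} {true}  {true}  () _
bit-balance {false} {true}  {true}  {true}  () _
bit-balance {true}  {_}     {false} {true}  _  _   = refl
bit-balance {true}  {_}     {false} {false} () _

-- H − u with x marked is a copy of the graphlet (G, r); these u are what the graphlet
-- degree of x for (G, r) counts, since G has one vertex fewer than H.
RootedCard : Graph (suc n) → Fin (suc n) → Graph n → Fin n → Fin (suc n) → Set
RootedCard H x G r u = Σ (u ≢ x) λ u≢x → Σ (Iso (H ─ u) G) λ f → isoMap f (punchOut u≢x) ≡ r

deletionCard : (K : Graph (suc n)) {u x : Fin (suc n)} (u≢x : u ≢ x) → RootedCard K x (K ─ u) (punchOut u≢x) u
deletionCard K u≢x = u≢x , Iso-refl , refl

module _ {n} {H : Graph (suc n)} {x : Fin (suc n)} {G : Graph n} {r : Fin n} where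

  card⇒inducedIso : ∀ {u} → RootedCard H x G r u → InducedIsoRooted H (∁ ⁅ u ⁆) x G r
  card⇒inducedIso {u} (u≢x , f , fx≡r) =
    x∉p⇒x∈∁p (u≢x ∘ sym ∘ x∈⁅y⁆⇒x≡y u) ,
    punchIn u ∘ isoMap⁻¹ f ,
    isoMap-injective (Iso-sym f) ∘ punchIn-injective u _ _ ,
    (λ y → mk⇔ (image⁺ y) (image⁻ y)) ,
    adj-isoMap⁻¹ f ,
    root
    where
    image⁺ : ∀ y → y Sub.∈ ∁ ⁅ u ⁆ → ∃ λ a → punchIn u (isoMap⁻¹ f a) ≡ y
    image⁺ y y∈S = isoMap f (punchOut u≢y) ,
      trans (cong (punchIn u) (isoMap⁻¹∘isoMap f _)) (punchIn-punchOut u≢y)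
      where
      u≢y : u ≢ y
      u≢y refl = x∈∁p⇒x∉p y∈S (x∈⁅x⁆ u)
    image⁻ : ∀ y → (∃ λ a → punchIn u (isoMap⁻¹ f a) ≡ y) → y Sub.∈ ∁ ⁅ u ⁆
    image⁻ y (a , refl) = x∉p⇒x∈∁p (punchInᵢ≢i u _ ∘ x∈⁅y⁆⇒x≡y u)
    root : punchIn u (isoMap⁻¹ f r) ≡ x
    root = begin
      punchIn u (isoMap⁻¹ f r)                            ≡⟨ cong (punchIn u ∘ isoMap⁻¹ f) fx≡r ⟨
      punchIn u (isoMap⁻¹ f (isoMap f (punchOut u≢x)))    ≡⟨ cong (punchIn u) (isoMap⁻¹∘isoMap f _) ⟩
      punchIn u (punchOut u≢x)                            ≡⟨ punchIn-punchOut u≢x ⟩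
      x                                                   ∎
      where open ≡-Reasoning

  inducedIso⇒card : ∀ {S} → InducedIsoRooted H S x G r → ∃ (RootedCard H x G r)
  inducedIso⇒card (_ , g , g-inj , _ , g-adj , gr≡x) =
    u , u≢x , Iso-sym φ , trans (cong (isoMap⁻¹ φ) φr≡x) (isoMap⁻¹∘isoMap φ r)
    where
    missed = ∃-notInImage (ℕ.n<1+n n) g
    u = proj₁ missed
    u≢g : ∀ a → u ≢ g a
    u≢g a = proj₂ missed a ∘ sym
    u≢x : u ≢ x
    u≢x u≡x = u≢g r (trans u≡x (sym gr≡x))
    φ : Iso G (H ─ u)
    φ = endoIso (λ a → punchOut (u≢g a))
          (λ {a} {b} → g-inj ∘ punchOut-injective (u≢g a) (u≢g b))
          (λ a b → trans (g-adj a b)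
                         (sym (cong₂ (adj H) (punchIn-punchOut (u≢g a)) (punchIn-punchOut (u≢g b)))))
    φr≡x : punchOut u≢x ≡ isoMap φ r
    φr≡x = punchOut-cong u (sym gr≡x)

  noCard⇒graphletDegree-0 : (∀ u → ¬ RootedCard H x G r u) → GraphletDegreeIs H x G r 0
  noCard⇒graphletDegree-0 noCard =
    [] , [] , refl , λ S → mk⇔ (λ ind → contradiction (proj₂ (inducedIso⇒card ind)) (noCard _)) λ ()

  graphletDegree-0⇒noCard : GraphletDegreeIs H x G r 0 → ∀ u → ¬ RootedCard H x G r u
  graphletDegree-0⇒noCard ([] , _ , _ , counts) u card
    with () ← Equivalence.to (counts _) (card⇒inducedIso card)

card-transfer : ∀ {H K : Graph (suc n)} {x y G r u} →
                (GraphletDegreeIs K y G r 0 → GraphletDegreeIs H x G r 0) →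
                RootedCard H x G r u → ¬ ¬ ∃ (RootedCard K y G r)
card-transfer {H = H} {K} back card noCard =
  graphletDegree-0⇒noCard {H = H} (back (noCard⇒graphletDegree-0 {H = K} (curry noCard))) _ card

card-adj : ∀ {K : Graph (suc n)} {y G r u} ((u≢y , f , fy≡r) : RootedCard K y G r u) →
           ∀ b → adj K y (punchIn u b) ≡ adj G r (isoMap f b)
card-adj {K = K} {y} {G} {r} {u} (u≢y , f , fy≡r) b = begin
  adj K y (punchIn u b)                        ≡⟨ cong (λ z → adj K z (punchIn u b)) (punchIn-punchOut u≢y) ⟨
  adj (K ─ u) (punchOut u≢y) b                 ≡⟨ pres f _ b ⟩
  adj G (isoMap f (punchOut u≢y)) (isoMap f b) ≡⟨ cong (λ z → adj G z (isoMap f b)) fy≡r ⟩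
  adj G r (isoMap f b)                         ∎
  where open ≡-Reasoning

card-neighbour : ∀ {K : Graph (suc n)} {y G r u} → RootedCard K y G r u →
                 ∀ {q} → adj G r q ≡ true → ∃ λ w → adj K y w ≡ true
card-neighbour {K = K} {G = G} {r} card@(_ , f , _) {q} r~q =
  _ , trans (card-adj {K = K} card (isoMap⁻¹ f q)) (trans (cong (adj G r) (isoMap∘isoMap⁻¹ f q)) r~q)

degree-card : ∀ {K : Graph (suc n)} {y G r u} → RootedCard K y G r u →
              degree K y ≡ bit (adj K y u) + degree G r
degree-card {K = K} {y} {G} {u = u} (u≢y , f , fy≡r) =
  trans (degree-─ K u≢y) (cong (bit (adj K y u) +_) (trans (degree-iso f _) (cong (degree G) fy≡r)))

position-independent : ∀ {H : Graph (suc n)} {v} → Rigid (H ─ v) → StarCondition H v →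
  ∀ {a b w} (ga : Iso (H ─ a) (H ─ v)) (gb : Iso (H ─ b) (H ─ v)) (a≢w : a ≢ w) (b≢w : b ≢ w) →
  isoMap ga (punchOut a≢w) ≡ isoMap gb (punchOut b≢w)
-- ga⁻¹ ∘ f ∘ gb, with f given by (*), is an automorphism of H − v, hence the identity.
position-independent rigid star {w = w} ga gb a≢w b≢w =
  trans (sym (rigid α _)) (cong (isoMap gb) (trans (cong (isoMap f) (isoMap⁻¹∘isoMap ga _)) fw≡w))
  where
  f = proj₁ (star w _ _ ga gb a≢w b≢w)
  fw≡w = proj₂ (star w _ _ ga gb a≢w b≢w)
  α = Iso-trans (Iso-sym ga) (Iso-trans f gb)

module Reconstruction {k} {H H' : Graph (4 + k)} (H-2conn : TwoConnected H) {v}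
  (A-rigid : Rigid (H ─ v)) (star : StarCondition H v) (gdd : SameGDD H H') where

  A : Graph (3 + k)
  A = H ─ v

  H-connected : Connected H
  H-connected = proj₁ (proj₂ H-2conn)

  H─-connected : ∀ u → Connected (H ─ u)
  H─-connected = proj₂ (proj₂ H-2conn)

  σ : Fin (4 + k) ⤖ Fin (4 + k)
  σ = proj₁ gdd

  s s⁻¹ : Fin (4 + k) → Fin (4 + k)
  s   = Bijection.to σ
  s⁻¹ = Bijection.to⁻ σ

  s∘s⁻¹ : ∀ y → s (s⁻¹ y) ≡ y
  s∘s⁻¹ y = proj₂ (Bijection.surjective σ y) refl

  s-≢ : ∀ {x y} → x ≢ y → s x ≢ s y
  s-≢ x≢y = x≢y ∘ Bijection.injective σ

  s⁻¹-≢ : ∀ {x y'} → y' ≢ s x → x ≢ s⁻¹ y'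
  s⁻¹-≢ {y' = y'} y'≢sx x≡ = y'≢sx (trans (sym (s∘s⁻¹ y')) (cong s (sym x≡)))

  card⇒card' : ∀ {x G r u} → Connected G → RootedCard H x G r u → ¬ ¬ ∃ (RootedCard H' (s x) G r)
  card⇒card' {x} {G} {r} G-conn = card-transfer {H = H} {H'} (Equivalence.from (proj₂ gdd x G G-conn r 0))

  card'⇒card : ∀ {x G r u} → Connected G → RootedCard H' (s x) G r u → ¬ ¬ ∃ (RootedCard H x G r)
  card'⇒card {x} {G} {r} G-conn = card-transfer {H = H'} {H} (Equivalence.to (proj₂ gdd x G G-conn r 0))

  position-transfer : ∀ {u' u x} (ψ : Iso (H' ─ u') A) (u'≢sx : u' ≢ s x) (g : Iso (H ─ u) A) (u≢x : u ≢ x) →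
                      isoMap ψ (punchOut u'≢sx) ≡ isoMap g (punchOut u≢x)
  position-transfer ψ u'≢sx g u≢x = decidable-stable (_ ≟ _) λ differ →
    card'⇒card (H─-connected v) (u'≢sx , ψ , refl) λ (_ , u₀≢x , g₀ , g₀x≡ψsx) →
      differ (trans (sym g₀x≡ψsx) (position-independent {H = H} A-rigid star g₀ g u₀≢x u≢x))

  ψ-fixes : ∀ {u' x} (ψ : Iso (H' ─ u') A) (u'≢sx : u' ≢ s x) (v≢x : v ≢ x) →
            isoMap ψ (punchOut u'≢sx) ≡ punchOut v≢x
  ψ-fixes ψ u'≢sx v≢x = position-transfer ψ u'≢sx Iso-refl v≢x

  positions-agree : ∀ {u₀ u₁ x} (ψ₀ : Iso (H' ─ u₀) A) (ψ₁ : Iso (H' ─ u₁) A)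
                    (u₀≢sx : u₀ ≢ s x) (u₁≢sx : u₁ ≢ s x) →
                    isoMap ψ₀ (punchOut u₀≢sx) ≡ isoMap ψ₁ (punchOut u₁≢sx)
  positions-agree ψ₀ ψ₁ u₀≢sx u₁≢sx = decidable-stable (_ ≟ _) λ differ →
    card'⇒card (H─-connected v) (u₀≢sx , ψ₀ , refl) λ (_ , u≢x , g , gx≡ψ₀sx) →
      differ (trans (sym gx≡ψ₀sx) (sym (position-transfer ψ₁ u₁≢sx g u≢x)))

  -- ψ sends each s x ≠ s v to x, so as a bijection it must send s v to the vertex s⁻¹ u' left over.
  ψ-at-sv : ∀ {u'} (ψ : Iso (H' ─ u') A) (u'≢sv : u' ≢ s v) →
            isoMap ψ (punchOut u'≢sv) ≡ punchOut (s⁻¹-≢ u'≢sv)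
  ψ-at-sv {u'} ψ u'≢sv = begin
    isoMap ψ (punchOut u'≢sv) ≡⟨ cong (isoMap ψ) (punchIn≡⇒≡punchOut u'≢sv y≡sv) ⟨
    isoMap ψ p                ≡⟨ isoMap∘isoMap⁻¹ ψ _ ⟩
    punchOut v≢z              ∎
    where
    open ≡-Reasoning
    v≢z = s⁻¹-≢ u'≢sv
    p = isoMap⁻¹ ψ (punchOut v≢z)
    y = punchIn u' p
    u'≢y : u' ≢ y
    u'≢y = punchInᵢ≢i u' p ∘ sym
    y≡sv : y ≡ s v
    y≡sv = decidable-stable (y ≟ s v) λ y≢sv →
      let x = s⁻¹ y
          u'≢sx : u' ≢ s x
          u'≢sx = subst (u' ≢_) (sym (s∘s⁻¹ y)) u'≢y
          ψsx≡ψp : isoMap ψ (punchOut u'≢sx) ≡ punchOut v≢z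
          ψsx≡ψp = trans (cong (isoMap ψ) (sym (punchIn≡⇒≡punchOut u'≢sx (sym (s∘s⁻¹ y))))) (isoMap∘isoMap⁻¹ ψ _)
          x≡z : x ≡ s⁻¹ u'
          x≡z = punchOut-injective (s⁻¹-≢ y≢sv) v≢z (trans (sym (ψ-fixes ψ u'≢sx _)) ψsx≡ψp)
      in u'≢y (trans (sym (s∘s⁻¹ u')) (trans (cong s (sym x≡z)) (s∘s⁻¹ y)))

  H'─u≅A-unique : ∀ {u₀ u₁} → Iso (H' ─ u₀) A → Iso (H' ─ u₁) A → u₀ ≢ s v → u₁ ≢ s v → u₀ ≡ u₁
  H'─u≅A-unique {u₀} {u₁} ψ₀ ψ₁ u₀≢sv u₁≢sv = begin
    u₀         ≡⟨ s∘s⁻¹ u₀ ⟨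
    s (s⁻¹ u₀) ≡⟨ cong s (punchOut-injective (s⁻¹-≢ u₀≢sv) (s⁻¹-≢ u₁≢sv) positions) ⟩
    s (s⁻¹ u₁) ≡⟨ s∘s⁻¹ u₁ ⟩
    u₁         ∎
    where
    open ≡-Reasoning
    positions = trans (sym (ψ-at-sv ψ₀ u₀≢sv))
                      (trans (positions-agree ψ₀ ψ₁ u₀≢sv u₁≢sv) (ψ-at-sv ψ₁ u₁≢sv))

  -- A-cards of H at some vertex and at s⁻¹ u₀ give A-cards of H' deleting u₀ and some u₁ ≠ u₀;
  -- by H'─u≅A-unique they cannot both avoid s v.
  ¬¬H'─sv≅A : ¬ ¬ Iso (H' ─ s v) A
  ¬¬H'─sv≅A noIso =
    card⇒card' (H─-connected v) (deletionCard H (punchInᵢ≢i v zero ∘ sym)) λ (u₀ , _ , ψ₀ , _) →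
    unless-sv ψ₀ λ u₀≢sv →
    card⇒card' (H─-connected v) (deletionCard H (s⁻¹-≢ u₀≢sv)) λ (u₁ , u₁≢u₀ , ψ₁ , _) →
    unless-sv ψ₁ λ u₁≢sv →
    u₁≢u₀ (trans (sym (H'─u≅A-unique ψ₀ ψ₁ u₀≢sv u₁≢sv)) (sym (s∘s⁻¹ u₀)))
    where
    unless-sv : ∀ {u} → Iso (H' ─ u) A → ¬ ¬ (u ≢ s v)
    unless-sv {u} ψ u≢sv⇒⊥ with u ≟ s v
    ... | yes refl = noIso ψ
    ... | no u≢sv  = u≢sv⇒⊥ u≢sv

  s-has-neighbour : ∀ z → ¬ ¬ ∃ λ w → adj H' (s z) w ≡ true
  s-has-neighbour z noNeighbour =
    card⇒card' (H─-connected x) (deletionCard H x≢z) λ (_ , card') →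
      noNeighbour (card-neighbour {K = H'} card' (proj₂ z°-neighbour))
    where
    x = punchIn z zero
    x≢z = punchInᵢ≢i z zero
    z° = punchOut x≢z
    z°-neighbour = Reachable⇒neighbour (H─-connected x z° (punchIn z° zero)) (punchInᵢ≢i z° zero ∘ sym)

  module _ (ψ : Iso (H' ─ s v) A) where

    ψ-fixes-all : ∀ {x} (v≢x : v ≢ x) → isoMap ψ (punchOut (s-≢ v≢x)) ≡ punchOut v≢x
    ψ-fixes-all v≢x = ψ-fixes ψ (s-≢ v≢x) v≢x

    adj-preserved-off-v : ∀ {x y} → v ≢ x → v ≢ y → adj H x y ≡ adj H' (s x) (s y)
    adj-preserved-off-v v≢x v≢y = begin
      adj H _ _                                        ≡⟨ cong₂ (adj H) (punchIn-punchOut v≢x) (punchIn-punchOut v≢y) ⟨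
      adj A (punchOut v≢x) (punchOut v≢y)              ≡⟨ cong₂ (adj A) (ψ-fixes-all v≢x) (ψ-fixes-all v≢y) ⟨
      adj A (isoMap ψ _) (isoMap ψ _)                  ≡⟨ pres ψ _ _ ⟨
      adj (H' ─ s v) (punchOut (s-≢ v≢x)) (punchOut (s-≢ v≢y))
                                                       ≡⟨ cong₂ (adj H') (punchIn-punchOut _) (punchIn-punchOut _) ⟩
      adj H' _ _                                       ∎
      where open ≡-Reasoning

    -- Count the neighbours of x in H, and of s x in H', in two ways each: through the
    -- A-cards deleting v and s v, and through the card deleting u and its counterpart in H'.
    degree-balance : ∀ {x u} → v ≢ x → u ≢ x → ¬ ¬ ∃ λ u' →
      bit (adj H x v) + bit (adj H' (s x) u') ≡ bit (adj H' (s x) (s v)) + bit (adj H x u)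
    degree-balance {x} {u} v≢x u≢x noBalance =
      card⇒card' (H─-connected u) (deletionCard H u≢x) λ (u' , card') →
        noBalance (u' , +-balance (bit (adj H x v)) (bit (adj H x u)) (bit (adj H' (s x) (s v))) (bit (adj H' (s x) u'))
          (trans (sym (degree-card {K = H} (deletionCard H v≢x))) (degree-card {K = H} (deletionCard H u≢x)))
          (trans (sym (degree-card {K = H'} (s-≢ v≢x , ψ , ψ-fixes-all v≢x))) (degree-card {K = H'} card')))

    mismatch⇒uniform : ∀ {x u} → v ≢ x → adj H x v ≢ adj H' (s x) (s v) → u ≢ x → adj H x u ≡ adj H x v
    mismatch⇒uniform v≢x mismatch u≢x = decidable-stable (_ Bool.≟ _) λ differ →
      degree-balance v≢x u≢x λ (_ , balance) → differ (bit-balance balance mismatch)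

    -- s x is adjacent to all of H' but s v, so deleting u' ∉ {s x, s v, w} leaves a connected
    -- card; its counterpart H − u would make x non-adjacent to the vertex playing the role of s v.
    universal⇒sv-isolated : ∀ {x w} → v ≢ x → (∀ {u} → u ≢ x → adj H x u ≡ true) →
                            adj H' (s x) (s v) ≡ false → adj H' (s v) w ≢ true
    universal⇒sv-isolated {x} {w} v≢x universal sx≁sv sv~w =
      card'⇒card H'─u'-connected (deletionCard H' u'≢sx) λ (u , card@(u≢x , φ , φx≡sx°)) →
        let q = isoMap⁻¹ φ sv°
            q≢x : punchIn u q ≢ x
            q≢x q≡x = v≢x (Bijection.injective σ (punchOut-injective u'≢sv u'≢sx (begin
              sv°                           ≡⟨ isoMap∘isoMap⁻¹ φ sv° ⟨
              isoMap φ q                    ≡⟨ cong (isoMap φ) (punchIn≡⇒≡punchOut u≢x q≡x) ⟩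
              isoMap φ (punchOut u≢x)       ≡⟨ φx≡sx° ⟩
              sx°                           ∎)))
        in contradiction (trans (sym (universal q≢x)) (begin
             adj H x (punchIn u q)          ≡⟨ card-adj {K = H} card q ⟩
             adj (H' ─ u') sx° (isoMap φ q) ≡⟨ cong (adj (H' ─ u') sx°) (isoMap∘isoMap⁻¹ φ sv°) ⟩
             adj (H' ─ u') sx° sv°          ≡⟨ cong₂ (adj H') (punchIn-punchOut u'≢sx) (punchIn-punchOut u'≢sv) ⟩
             adj H' (s x) (s v)             ≡⟨ sx≁sv ⟩
             false                          ∎)) λ ()
      where
      open ≡-Reasoning
      sx~ : ∀ {y'} → y' ≢ s x → y' ≢ s v → adj H' (s x) y' ≡ true
      sx~ {y'} y'≢sx y'≢sv = begin
        adj H' (s x) y'                ≡⟨ cong (adj H' (s x)) (s∘s⁻¹ y') ⟨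
        adj H' (s x) (s (s⁻¹ y'))      ≡⟨ adj-preserved-off-v v≢x (s⁻¹-≢ y'≢sv) ⟨
        adj H x (s⁻¹ y')               ≡⟨ universal (s⁻¹-≢ y'≢sx ∘ sym) ⟩
        true                           ∎
      missing = ∃-notInImage (ℕ.m≤m+n 4 k) λ where
        zero             → s x
        (suc zero)       → s v
        (suc (suc zero)) → w
      u' = proj₁ missing
      u'≢sx : u' ≢ s x
      u'≢sx = proj₂ missing zero ∘ sym
      u'≢sv : u' ≢ s v
      u'≢sv = proj₂ missing (suc zero) ∘ sym
      u'≢w : u' ≢ w
      u'≢w = proj₂ missing (suc (suc zero)) ∘ sym
      sx° = punchOut u'≢sx
      sv° = punchOut u'≢sv
      H'─u'-connected : Connected (H' ─ u')
      H'─u'-connected = hub─-connected H' (λ _ → sx~) sx≁sv sv~w u'≢sx u'≢sv u'≢w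

    adj-v-preserved : ∀ {x} → v ≢ x → adj H x v ≡ adj H' (s x) (s v)
    adj-v-preserved {x} v≢x = decidable-stable (_ Bool.≟ _) λ mismatch →
      let uniform : ∀ {u} → u ≢ x → adj H x u ≡ adj H x v
          uniform = mismatch⇒uniform v≢x mismatch
          (c , x~c) = Reachable⇒neighbour (H-connected x v) (v≢x ∘ sym)
          c≢x : c ≢ x
          c≢x c≡x = contradiction (trans (sym (irref H x)) (trans (cong (adj H x) (sym c≡x)) x~c)) λ ()
          x~v = trans (sym (uniform c≢x)) x~c
      in s-has-neighbour v λ (_ , sv~w) →
           universal⇒sv-isolated v≢x (λ u≢x → trans (uniform u≢x) x~v)
             (Bool.¬-not λ sx~sv → mismatch (trans x~v (sym sx~sv))) sv~w

    s-preserves-adj : ∀ x y → adj H x y ≡ adj H' (s x) (s y)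
    s-preserves-adj x y with v ≟ x | v ≟ y
    ... | yes refl | yes refl = trans (irref H v) (sym (irref H' (s v)))
    ... | yes refl | no v≢y   = trans (Graph.sym H v y) (trans (adj-v-preserved v≢y) (Graph.sym H' (s y) (s v)))
    ... | no v≢x   | yes refl = adj-v-preserved v≢x
    ... | no v≢x   | no v≢y   = adj-preserved-off-v v≢x v≢y

  H≅H' : Iso H H'
  H≅H' = record
    { bij  = σ
    ; pres = λ x y → decidable-stable (_ Bool.≟ _) λ differ →
               ¬¬H'─sv≅A λ ψ → differ (s-preserves-adj ψ x y)
    }

mainTheorem1 : (m : ℕ) (H : Graph (suc m)) → TwoConnected H →
               (v : Fin (suc m)) → Rigid (H ─ v) → StarCondition H v →
               (H' : Graph (suc m)) → SameGDD H H' → Iso H H'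
mainTheorem1 0 H (ℕ.s≤s () , _) _ _ _ _ _
mainTheorem1 1 H (ℕ.s≤s (ℕ.s≤s ()) , _) _ _ _ _ _
mainTheorem1 2 H _ v rigid _ _ _ = contradiction rigid (¬rigid-2 (H ─ v))
mainTheorem1 (suc (suc (suc k))) H H-2conn v rigid star H' gdd =
  Reconstruction.H≅H' H-2conn rigid star gdd
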